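{- A quadrilateral tiling of a compact connected surface without boundary is the quadrilateral subdivision $T(4)$ of some tiling $T$ if and only if it is possible to label some vertices by $\bullet$ and some other vertices by $\circ$ such that every tile is of type $Q$ or $Q'$, where: a tile of type $Q$ is a non-degenerate quadrilateral with one $\bullet$-vertex, one $\circ$-vertex not adjacent to it (i.e. opposite), and two further unlabelled vertices of degree $4$; a tile of type $Q'$ is obtained from such a quadrilateral (with corners $\bullet$, $w_1$, $\circ$, $w_2$ in cyclic order) by identifying the two unlabelled corners $w_1,w_2$ into a single unlabelled vertex of degree $4$, in a twisted way, so that the union of the tile with a small disk neighborhood of that vertex is a Möbius band.
   Context: A tiling of a compact connected surface without boundary is a graph embedded in the surface such that the complementary regions (tiles) are open disks; tilings are edge-to-edge, every vertex has degree at least $3$, every tile has at least $3$ edges, and tiles may be degenerate (boundary not a simple closed curve); a polygon is non-degenerate if its boundary is a simple closed curve. A quadrilateral tiling has $4$ edges along each tile boundary. Quadrilateral subdivision: given a tiling $T$, choose a middle point on each edge and a center point in each tile, and join the center of each tile to the middle point of each edge on the tile's boundary (once for each occurrence of the edge on the boundary). The resulting quadrilateral tiling is $T(4)$ (the union of $T$ and its dual); no orientation is needed. -}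

module Defs where

-- Tilings of compact connected surfaces without boundary are encoded
-- combinatorially as generalized maps (gems): the flags (triangles of the
-- barycentric subdivision) form a finite set Fin n, with three
-- fixed-point-free involutions
--   σ₀ : change the vertex, keep edge and tile
--   σ₁ : change the edge,   keep vertex and tile
--   σ₂ : change the tile,   keep vertex and edge
-- such that σ₀σ₂ = σ₂σ₀ is a fixed-point-free involution, and the action
-- is transitive (connected surface).  Vertices = orbits of ⟨σ₁,σ₂⟩,
-- edges = orbits of ⟨σ₀,σ₂⟩, tiles = orbits of ⟨σ₀,σ₁⟩.
-- Degree of a vertex = period of σ₂∘σ₁ on any of its flags;
-- number of edges of a tile = period of σ₁∘σ₀ on any of its flags.

open import Data.Nat using (ℕ; zero; suc; _<_)
open import Data.Fin using (Fin; toℕ) renaming (zero to f0; suc to fs)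
open import Data.Product using (Σ; ∃; _×_; _,_)
open import Data.Sum using (_⊎_)
open import Relation.Binary.PropositionalEquality using (_≡_; _≢_)
open import Relation.Nullary using (¬_)
open import Function.Bundles using (_↔_; Inverse)

iter : {A : Set} → (A → A) → ℕ → A → A
iter f zero x = x
iter f (suc k) x = f (iter f k x)

Involution : {A : Set} → (A → A) → Set
Involution f = ∀ x → f (f x) ≡ x

FixedPointFree : {A : Set} → (A → A) → Set
FixedPointFree f = ∀ x → f x ≢ x

data Reach2 {A : Set} (f g : A → A) : A → A → Set where
  done  : ∀ {x} → Reach2 f g x x
  stepf : ∀ {x y} → Reach2 f g (f x) y → Reach2 f g x y
  stepg : ∀ {x y} → Reach2 f g (g x) y → Reach2 f g x y

data Reach3 {A : Set} (f g h : A → A) : A → A → Set where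
  done  : ∀ {x} → Reach3 f g h x x
  stepf : ∀ {x y} → Reach3 f g h (f x) y → Reach3 f g h x y
  stepg : ∀ {x y} → Reach3 f g h (g x) y → Reach3 f g h x y
  steph : ∀ {x y} → Reach3 f g h (h x) y → Reach3 f g h x y

HasPeriod : {A : Set} → (A → A) → A → ℕ → Set
HasPeriod f x d =
  (0 < d) × (iter f d x ≡ x) × (∀ k → 0 < k → k < d → iter f k x ≢ x)

PeriodAtLeast3 : {A : Set} → (A → A) → A → Set
PeriodAtLeast3 f x = ∀ k → 0 < k → k < 3 → iter f k x ≢ x

record GMap (n : ℕ) : Set where
  field
    σ₀ σ₁ σ₂  : Fin n → Fin n
    inv₀      : Involution σ₀
    inv₁      : Involution σ₁
    inv₂      : Involution σ₂
    fpf₀      : FixedPointFree σ₀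
    fpf₁      : FixedPointFree σ₁
    fpf₂      : FixedPointFree σ₂
    comm₀₂    : ∀ x → σ₀ (σ₂ x) ≡ σ₂ (σ₀ x)
    fpf₀₂     : FixedPointFree (λ x → σ₀ (σ₂ x))
    nonempty  : Fin n
    connected : ∀ x y → Reach3 σ₀ σ₁ σ₂ x y

module _ {n : ℕ} (G : GMap n) where
  open GMap G

  -- rotation around a vertex, and along the boundary of a tile
  ρv : Fin n → Fin n
  ρv x = σ₂ (σ₁ x)

  ρf : Fin n → Fin n
  ρf x = σ₁ (σ₀ x)

  SameVertex : Fin n → Fin n → Set
  SameVertex = Reach2 σ₁ σ₂

  SameFace : Fin n → Fin n → Set
  SameFace = Reach2 σ₀ σ₁

  Degree : Fin n → ℕ → Set
  Degree x d = HasPeriod ρv x d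

  IsTiling : Set
  IsTiling = ∀ x → PeriodAtLeast3 ρv x × PeriodAtLeast3 ρf x

  IsQuadTiling : Set
  IsQuadTiling = IsTiling × (∀ x → HasPeriod ρf x 4)

-- Quadrilateral subdivision T(4) of a gem T on Fin m: flags Fin m × Fin 4.
-- Flag x of T (triangle v,m,c = vertex, edge-midpoint, tile-center) is cut
-- into the four T(4)-flags 0=(v,a), 1=(m,a), 2=(m,b), 3=(c,b), where a,b are
-- the midpoints of the T(4)-edges vm and mc.
module _ {m : ℕ} (T : GMap m) where
  open GMap T

  τ₀ τ₁ τ₂ : Fin m × Fin 4 → Fin m × Fin 4
  τ₀ (x , f0)                = (x , fs f0)
  τ₀ (x , fs f0)             = (x , f0)
  τ₀ (x , fs (fs f0))        = (x , fs (fs (fs f0)))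
  τ₀ (x , fs (fs (fs f0)))   = (x , fs (fs f0))

  τ₁ (x , f0)                = (σ₁ x , f0)
  τ₁ (x , fs f0)             = (x , fs (fs f0))
  τ₁ (x , fs (fs f0))        = (x , fs f0)
  τ₁ (x , fs (fs (fs f0)))   = (σ₁ x , fs (fs (fs f0)))

  τ₂ (x , f0)                = (σ₂ x , f0)
  τ₂ (x , fs f0)             = (σ₂ x , fs f0)
  τ₂ (x , fs (fs f0))        = (σ₀ x , fs (fs f0))
  τ₂ (x , fs (fs (fs f0)))   = (σ₀ x , fs (fs (fs f0)))

record IsoToT4 {n m : ℕ} (G : GMap n) (T : GMap m) : Set where
  open GMap G
  field
    φ     : Fin n ↔ (Fin m × Fin 4)
  open Inverse φ using (to)
  field
    com₀  : ∀ x → to (σ₀ x) ≡ τ₀ T (to x)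
    com₁  : ∀ x → to (σ₁ x) ≡ τ₁ T (to x)
    com₂  : ∀ x → to (σ₂ x) ≡ τ₂ T (to x)

IsQuadSubdivision : {n : ℕ} → GMap n → Set
IsQuadSubdivision G = Σ ℕ λ m → Σ (GMap m) λ T → IsTiling T × IsoToT4 G T

data Label : Set where
  bullet circ unlabelled : Label

module _ {n : ℕ} (G : GMap n) where
  open GMap G

  Labelling : Set
  Labelling = Σ (Fin n → Label) λ ℓ → ∀ x → (ℓ (σ₁ x) ≡ ℓ x) × (ℓ (σ₂ x) ≡ ℓ x)

  corner : Fin n → ℕ → Fin n
  corner y i = iter (ρf G) i y

  NonDegenerateQuad : Fin n → Set
  NonDegenerateQuad y =
    ∀ (i j : Fin 4) → toℕ i ≢ toℕ j → ¬ SameVertex G (corner y (toℕ i)) (corner y (toℕ j))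

  LabelPattern : (Fin n → Label) → Fin n → Set
  LabelPattern ℓ y =
    (ℓ (corner y 0) ≡ bullet) × (ℓ (corner y 1) ≡ unlabelled) ×
    (ℓ (corner y 2) ≡ circ)   × (ℓ (corner y 3) ≡ unlabelled)

  TypeQ : (Fin n → Label) → Fin n → Set
  TypeQ ℓ y = NonDegenerateQuad y × LabelPattern ℓ y ×
              Degree G (corner y 1) 4 × Degree G (corner y 3) 4

  -- w₁ = w₂ is a single vertex of degree 4, and the two corners of the tile
  -- at it are glued in the twisted (Möbius) way: going around the vertex
  -- from the flag ρf y (corner w₁, edge w₁∘) via σ₂,σ₁,σ₂ one arrives at the
  -- flag ρf³ y (corner w₂, edge w₂•) rather than σ₀ ρf² y (orientable gluing).
  TypeQ' : (Fin n → Label) → Fin n → Set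
  TypeQ' ℓ y = LabelPattern ℓ y ×
               SameVertex G (corner y 1) (corner y 3) ×
               Degree G (corner y 1) 4 ×
               (σ₂ (σ₁ (σ₂ (corner y 1))) ≡ corner y 3)

  GoodLabelling : Labelling → Set
  GoodLabelling (ℓ , _) =
    ∀ x → ∃ λ y → SameFace G x y × (TypeQ ℓ y ⊎ TypeQ' ℓ y)

-- In T(4) every flag of T splits
-- into four flags sitting at a vertex of T (label •), at an edge midpoint
-- (unlabelled, twice) and at a tile centre (label ∘).
--
-- (⇒) Transport this labelling to G through the isomorphism G ≅ T(4).  Each
--     tile of T(4) is a quadrilateral (•, midpoint, ∘, midpoint); the midpoint
--     vertices have degree 4, and the two midpoints coincide exactly when the
--     edge of T is glued to itself in the twisted way (type Q'); otherwise
--     the four corners are distinct (type Q).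
-- (⇐) The flags of G labelled • are the flags of the tiling T.  T inherits
--     σ₁, σ₂ from G, while σ₀ crosses the unlabelled degree-4 midpoint vertex.
--     Every flag of G is one of the four subdivision flags of a unique
--     •-flag, which gives the isomorphism G ≅ T(4).
module Submission where

open import Defs
open import Data.Nat using (ℕ; zero; suc; _<_; s≤s; z≤n)
open import Data.Fin using (Fin; toℕ) renaming (zero to f0; suc to fs)
open import Data.Fin.Properties using () renaming (_≟_ to _≟F_)
open import Data.Bool using (Bool; true; false)
open import Data.Bool.Properties using () renaming (_≟_ to _≟B_)
open import Data.Product using (∃; Σ; _×_; _,_; proj₁; proj₂)
open import Data.Sum using (_⊎_; inj₁; inj₂)
open import Data.Empty using (⊥; ⊥-elim)
open import Function.Base using (_∘_)
open import Relation.Nullary using (¬_; yes; no)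
open import Relation.Binary.PropositionalEquality
open import Axiom.UniquenessOfIdentityProofs using (module Decidable⇒UIP)
open import Function.Bundles using (_⇔_; mk⇔; Inverse; mk↔ₛ′)

iter-conj : ∀ {A B : Set} {f : A → A} {g : B → B} (h : A → B) →
            (∀ x → h (f x) ≡ g (h x)) → ∀ k x → h (iter f k x) ≡ iter g k (h x)
iter-conj h hf zero x = refl
iter-conj {g = g} h hf (suc k) x = trans (hf _) (cong g (iter-conj h hf k x))

iter-shift : ∀ {A : Set} (f : A → A) k x → iter f (suc k) x ≡ iter f k (f x)
iter-shift f zero x = refl
iter-shift f (suc k) x = cong f (iter-shift f k x)

iter-cancel : ∀ {A : Set} {f g : A → A} → (∀ x → g (f x) ≡ x) →
              ∀ k x → iter g k (iter f k x) ≡ x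
iter-cancel gf zero x = refl
iter-cancel {f = f} {g} gf (suc k) x = begin
  iter g (suc k) (iter f (suc k) x)  ≡⟨ iter-shift g k _ ⟩
  iter g k (g (f (iter f k x)))      ≡⟨ cong (iter g k) (gf _) ⟩
  iter g k (iter f k x)              ≡⟨ iter-cancel gf k x ⟩
  x                                  ∎
  where open ≡-Reasoning

fixed-inverse : ∀ {A : Set} {f g : A → A} → (∀ x → g (f x) ≡ x) →
                ∀ k x → iter f k x ≡ x → iter g k x ≡ x
fixed-inverse {g = g} gf k x fx = trans (cong (iter g k) (sym fx)) (iter-cancel gf k x)

half-turn : ∀ {A : Set} {f g : A → A} → (∀ x → g (f x) ≡ x) →
            ∀ x → iter f 4 x ≡ x → iter f 2 x ≡ iter g 2 x
half-turn {f = f} {g} gf x f⁴x = trans (sym (iter-cancel {f = f} {g} gf 2 (iter f 2 x))) (cong (iter g 2) f⁴x)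

PeriodAtLeast3-inverse : ∀ {A : Set} {f g : A → A} → (∀ x → f (g x) ≡ x) →
                         ∀ x → PeriodAtLeast3 f x → PeriodAtLeast3 g x
PeriodAtLeast3-inverse fg x p k k>0 k<3 gᵏx = p k k>0 k<3 (fixed-inverse fg k x gᵏx)

PeriodAtLeast3-pullback : ∀ {A B : Set} {f : A → A} {g : B → B} (h : A → B) →
  (∀ x → h (f x) ≡ g (h x)) → ∀ x → PeriodAtLeast3 g (h x) → PeriodAtLeast3 f x
PeriodAtLeast3-pullback h hf x p k k>0 k<3 fᵏx =
  p k k>0 k<3 (trans (sym (iter-conj h hf k x)) (cong h fᵏx))

HasPeriod-pullback : ∀ {A B : Set} {f : A → A} {g : B → B} (h : A → B) →
  (∀ {a b} → h a ≡ h b → a ≡ b) → (∀ x → h (f x) ≡ g (h x)) →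
  ∀ x d → HasPeriod g (h x) d → HasPeriod f x d
HasPeriod-pullback h inj hf x d (d>0 , gᵈ , minimal) =
  d>0 , inj (trans (iter-conj h hf d x) gᵈ) ,
  λ k k>0 k<d fᵏx → minimal k k>0 k<d (trans (sym (iter-conj h hf k x)) (cong h fᵏx))

Reach2-trans : ∀ {A : Set} {f g : A → A} {x y z} → Reach2 f g x y → Reach2 f g y z → Reach2 f g x z
Reach2-trans done q = q
Reach2-trans (stepf p) q = stepf (Reach2-trans p q)
Reach2-trans (stepg p) q = stepg (Reach2-trans p q)

Reach2-≡ : ∀ {A : Set} {f g : A → A} {x y} → x ≡ y → Reach2 f g x y
Reach2-≡ refl = done

Reach2-sym : ∀ {A : Set} {f g : A → A} → Involution f → Involution g →
             ∀ {x y} → Reach2 f g x y → Reach2 f g y x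
Reach2-sym if ig done = done
Reach2-sym if ig {x} (stepf p) = Reach2-trans (Reach2-sym if ig p) (stepf (Reach2-≡ (if x)))
Reach2-sym if ig {x} (stepg p) = Reach2-trans (Reach2-sym if ig p) (stepg (Reach2-≡ (ig x)))

Reach2-invariant : ∀ {A : Set} {f g : A → A} (P : A → Set) →
  (∀ x → P x → P (f x)) → (∀ x → P x → P (g x)) → ∀ {x y} → Reach2 f g x y → P x → P y
Reach2-invariant P hf hg done px = px
Reach2-invariant P hf hg (stepf p) px = Reach2-invariant P hf hg p (hf _ px)
Reach2-invariant P hf hg (stepg p) px = Reach2-invariant P hf hg p (hg _ px)

Reach2-map : ∀ {A B : Set} {f g : A → A} {f' g' : B → B} (h : A → B) →
  (∀ x → h (f x) ≡ f' (h x)) → (∀ x → h (g x) ≡ g' (h x)) →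
  ∀ {x y} → Reach2 f g x y → Reach2 f' g' (h x) (h y)
Reach2-map h hf hg done = done
Reach2-map {f' = f'} {g'} h hf hg {y = y} (stepf p) =
  stepf (subst (λ z → Reach2 f' g' z (h y)) (hf _) (Reach2-map h hf hg p))
Reach2-map {f' = f'} {g'} h hf hg {y = y} (stepg p) =
  stepg (subst (λ z → Reach2 f' g' z (h y)) (hg _) (Reach2-map h hf hg p))

Reach3-trans : ∀ {A : Set} {f g h : A → A} {x y z} → Reach3 f g h x y → Reach3 f g h y z → Reach3 f g h x z
Reach3-trans done q = q
Reach3-trans (stepf p) q = stepf (Reach3-trans p q)
Reach3-trans (stepg p) q = stepg (Reach3-trans p q)
Reach3-trans (steph p) q = steph (Reach3-trans p q)

module VertexRotation {n : ℕ} (G : GMap n) where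
  open GMap G

  ρv⁻¹ : Fin n → Fin n
  ρv⁻¹ x = σ₁ (σ₂ x)

  ρv⁻¹-ρv : ∀ x → ρv⁻¹ (ρv G x) ≡ x
  ρv⁻¹-ρv x = trans (cong σ₁ (inv₂ (σ₁ x))) (inv₁ x)

  ρv-ρv⁻¹ : ∀ x → ρv G (ρv⁻¹ x) ≡ x
  ρv-ρv⁻¹ x = trans (cong σ₂ (inv₁ (σ₂ x))) (inv₂ x)

  σ₁-reverses : ∀ x → σ₁ (ρv⁻¹ x) ≡ ρv G (σ₁ x)
  σ₁-reverses x = trans (inv₁ (σ₂ x)) (cong σ₂ (sym (inv₁ x)))

  σ₂-reverses : ∀ x → σ₂ (ρv⁻¹ x) ≡ ρv G (σ₂ x)
  σ₂-reverses x = refl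

  RotationFixes : ℕ → Fin n → Set
  RotationFixes k x = iter (ρv G) k x ≡ x

  rotationFixes-step : ∀ (σ : Fin n → Fin n) → (∀ x → σ (ρv⁻¹ x) ≡ ρv G (σ x)) →
                       ∀ k x → RotationFixes k x → RotationFixes k (σ x)
  rotationFixes-step σ rev k x fx =
    trans (sym (iter-conj σ rev k x)) (cong σ (fixed-inverse ρv⁻¹-ρv k x fx))

  rotationFixes-along : ∀ k {x y} → SameVertex G x y → RotationFixes k x → RotationFixes k y
  rotationFixes-along k = Reach2-invariant (RotationFixes k)
    (rotationFixes-step σ₁ σ₁-reverses k) (rotationFixes-step σ₂ σ₂-reverses k)

  degree-sameVertex : ∀ {x y d} → SameVertex G x y → Degree G x d → Degree G y d
  degree-sameVertex {d = d} p (d>0 , fixed , minimal) =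
    d>0 , rotationFixes-along d p fixed ,
    λ k k>0 k<d fy → minimal k k>0 k<d (rotationFixes-along k (Reach2-sym inv₁ inv₂ p) fy)

cornerLabel : Fin 4 → Label
cornerLabel f0 = bullet
cornerLabel (fs f0) = unlabelled
cornerLabel (fs (fs f0)) = circ
cornerLabel (fs (fs (fs f0))) = unlabelled

module LabelledTile {n : ℕ} (G : GMap n) (L : Labelling G) where
  open GMap G
  ℓ = proj₁ L

  label-sameVertex : ∀ {a b} → SameVertex G a b → ℓ a ≡ ℓ b
  label-sameVertex {a} p = Reach2-invariant (λ z → ℓ a ≡ ℓ z)
    (λ x e → trans e (sym (proj₁ (proj₂ L x)))) (λ x e → trans e (sym (proj₂ (proj₂ L x)))) p refl

  pattern-corner : ∀ {y} → LabelPattern G ℓ y → ∀ i → ℓ (corner G y (toℕ i)) ≡ cornerLabel i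
  pattern-corner (l₀ , l₁ , l₂ , l₃) f0 = l₀
  pattern-corner (l₀ , l₁ , l₂ , l₃) (fs f0) = l₁
  pattern-corner (l₀ , l₁ , l₂ , l₃) (fs (fs f0)) = l₂
  pattern-corner (l₀ , l₁ , l₂ , l₃) (fs (fs (fs f0))) = l₃

  -- corners with distinct labels lie at distinct vertices, so a labelled
  -- quadrilateral is non-degenerate as soon as its two unlabelled corners are
  -- at distinct vertices
  pattern-nonDegenerate : ∀ {y} → LabelPattern G ℓ y →
    ¬ SameVertex G (corner G y 1) (corner G y 3) → NonDegenerateQuad G y
  pattern-nonDegenerate {y} pat w₁≠w₂ i j i≢j sv = distinct i j i≢j sv
    where
    labelsAgree : ∀ i j → SameVertex G (corner G y (toℕ i)) (corner G y (toℕ j)) →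
                  cornerLabel i ≡ cornerLabel j
    labelsAgree i j sv = trans (sym (pattern-corner pat i))
                               (trans (label-sameVertex sv) (pattern-corner pat j))
    distinct : ∀ i j → toℕ i ≢ toℕ j → ¬ SameVertex G (corner G y (toℕ i)) (corner G y (toℕ j))
    distinct (fs f0) (fs (fs (fs f0))) _ sv = w₁≠w₂ sv
    distinct (fs (fs (fs f0))) (fs f0) _ sv = w₁≠w₂ (Reach2-sym inv₁ inv₂ sv)
    distinct f0 f0 i≢j _ = i≢j refl
    distinct (fs f0) (fs f0) i≢j _ = i≢j refl
    distinct (fs (fs f0)) (fs (fs f0)) i≢j _ = i≢j refl
    distinct (fs (fs (fs f0))) (fs (fs (fs f0))) i≢j _ = i≢j refl
    distinct f0 (fs f0) _ sv with labelsAgree f0 (fs f0) sv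
    ... | ()
    distinct f0 (fs (fs f0)) _ sv with labelsAgree f0 (fs (fs f0)) sv
    ... | ()
    distinct f0 (fs (fs (fs f0))) _ sv with labelsAgree f0 (fs (fs (fs f0))) sv
    ... | ()
    distinct (fs f0) f0 _ sv with labelsAgree (fs f0) f0 sv
    ... | ()
    distinct (fs f0) (fs (fs f0)) _ sv with labelsAgree (fs f0) (fs (fs f0)) sv
    ... | ()
    distinct (fs (fs f0)) f0 _ sv with labelsAgree (fs (fs f0)) f0 sv
    ... | ()
    distinct (fs (fs f0)) (fs f0) _ sv with labelsAgree (fs (fs f0)) (fs f0) sv
    ... | ()
    distinct (fs (fs f0)) (fs (fs (fs f0))) _ sv with labelsAgree (fs (fs f0)) (fs (fs (fs f0))) sv
    ... | ()
    distinct (fs (fs (fs f0))) f0 _ sv with labelsAgree (fs (fs (fs f0))) f0 sv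
    ... | ()
    distinct (fs (fs (fs f0))) (fs (fs f0)) _ sv with labelsAgree (fs (fs (fs f0))) (fs (fs f0)) sv
    ... | ()

-- The quadrilateral subdivision T(4)

positionLabel : Fin 4 → Label
positionLabel f0 = bullet
positionLabel (fs f0) = unlabelled
positionLabel (fs (fs f0)) = unlabelled
positionLabel (fs (fs (fs f0))) = circ

module Subdivision {m : ℕ} (T : GMap m) where
  open GMap T

  τρv τρf : Fin m × Fin 4 → Fin m × Fin 4
  τρv p = τ₂ T (τ₁ T p)
  τρf p = τ₁ T (τ₀ T p)

  positionLabel-τ₁ : ∀ p → positionLabel (proj₂ (τ₁ T p)) ≡ positionLabel (proj₂ p)
  positionLabel-τ₁ (t , f0) = refl
  positionLabel-τ₁ (t , fs f0) = refl
  positionLabel-τ₁ (t , fs (fs f0)) = refl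
  positionLabel-τ₁ (t , fs (fs (fs f0))) = refl

  positionLabel-τ₂ : ∀ p → positionLabel (proj₂ (τ₂ T p)) ≡ positionLabel (proj₂ p)
  positionLabel-τ₂ (t , f0) = refl
  positionLabel-τ₂ (t , fs f0) = refl
  positionLabel-τ₂ (t , fs (fs f0)) = refl
  positionLabel-τ₂ (t , fs (fs (fs f0))) = refl

  tile-base : ∀ p → Reach2 (τ₀ T) (τ₁ T) p (proj₁ p , f0)
  tile-base (t , f0) = done
  tile-base (t , fs f0) = stepf done
  tile-base (t , fs (fs f0)) = stepg (stepf done)
  tile-base (t , fs (fs (fs f0))) = stepf (stepg (stepf done))

  σ₀σ₂-involution : ∀ u → σ₀ (σ₂ (σ₀ (σ₂ u))) ≡ u
  σ₀σ₂-involution u = trans (cong σ₀ (trans (sym (comm₀₂ (σ₂ u))) (cong σ₀ (inv₂ u)))) (inv₀ u)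

  σ₂σ₀-involution : ∀ u → σ₂ (σ₀ (σ₂ (σ₀ u))) ≡ u
  σ₂σ₀-involution u = trans (cong σ₂ (trans (comm₀₂ (σ₀ u)) (cong σ₂ (inv₀ u)))) (inv₂ u)

  -- edge midpoints have degree 4: the rotation runs through the four flags
  -- (u , i) with u in the edge orbit {u, σ₂u, σ₀u, σ₀σ₂u}
  midpoint-degree₁ : ∀ u → HasPeriod τρv (u , fs f0) 4
  midpoint-degree₁ u = s≤s z≤n , cong (_, fs f0) (σ₂σ₀-involution u) , minimal
    where
    minimal : ∀ k → 0 < k → k < 4 → iter τρv k (u , fs f0) ≢ (u , fs f0)
    minimal 1 _ _ ()
    minimal 2 _ _ e = fpf₀₂ u (trans (comm₀₂ u) (cong proj₁ e))
    minimal 3 _ _ ()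
    minimal (suc (suc (suc (suc _)))) _ (s≤s (s≤s (s≤s (s≤s ()))))

  midpoint-degree₂ : ∀ u → HasPeriod τρv (u , fs (fs f0)) 4
  midpoint-degree₂ u = s≤s z≤n , cong (_, fs (fs f0)) (σ₀σ₂-involution u) , minimal
    where
    minimal : ∀ k → 0 < k → k < 4 → iter τρv k (u , fs (fs f0)) ≢ (u , fs (fs f0))
    minimal 1 _ _ ()
    minimal 2 _ _ e = fpf₀₂ u (cong proj₁ e)
    minimal 3 _ _ ()
    minimal (suc (suc (suc (suc _)))) _ (s≤s (s≤s (s≤s (s≤s ()))))

  EdgeOrbit : Fin m → Fin m → Set
  EdgeOrbit t u = u ≡ t ⊎ u ≡ σ₂ t ⊎ u ≡ σ₀ t ⊎ u ≡ σ₀ (σ₂ t)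

  edgeOrbit-σ₂ : ∀ {t u} → EdgeOrbit t u → EdgeOrbit t (σ₂ u)
  edgeOrbit-σ₂ (inj₁ refl) = inj₂ (inj₁ refl)
  edgeOrbit-σ₂ {t} (inj₂ (inj₁ refl)) = inj₁ (inv₂ t)
  edgeOrbit-σ₂ {t} (inj₂ (inj₂ (inj₁ refl))) = inj₂ (inj₂ (inj₂ (sym (comm₀₂ t))))
  edgeOrbit-σ₂ {t} (inj₂ (inj₂ (inj₂ refl))) =
    inj₂ (inj₂ (inj₁ (trans (sym (comm₀₂ (σ₂ t))) (cong σ₀ (inv₂ t)))))

  edgeOrbit-σ₀ : ∀ {t u} → EdgeOrbit t u → EdgeOrbit t (σ₀ u)
  edgeOrbit-σ₀ (inj₁ refl) = inj₂ (inj₂ (inj₁ refl))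
  edgeOrbit-σ₀ (inj₂ (inj₁ refl)) = inj₂ (inj₂ (inj₂ refl))
  edgeOrbit-σ₀ {t} (inj₂ (inj₂ (inj₁ refl))) = inj₁ (inv₀ t)
  edgeOrbit-σ₀ {t} (inj₂ (inj₂ (inj₂ refl))) = inj₂ (inj₁ (inv₀ (σ₂ t)))

  AtMidpoint : Fin m → Fin m × Fin 4 → Set
  AtMidpoint t p = Σ (Fin m) λ u → EdgeOrbit t u × (p ≡ (u , fs f0) ⊎ p ≡ (u , fs (fs f0)))

  atMidpoint-vertex : ∀ {t p q} → Reach2 (τ₁ T) (τ₂ T) p q → AtMidpoint t p → AtMidpoint t q
  atMidpoint-vertex = Reach2-invariant (AtMidpoint _) step₁ step₂
    where
    step₁ : ∀ {t} p → AtMidpoint t p → AtMidpoint t (τ₁ T p)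
    step₁ _ (u , eo , inj₁ refl) = u , eo , inj₂ refl
    step₁ _ (u , eo , inj₂ refl) = u , eo , inj₁ refl
    step₂ : ∀ {t} p → AtMidpoint t p → AtMidpoint t (τ₂ T p)
    step₂ _ (u , eo , inj₁ refl) = σ₂ u , edgeOrbit-σ₂ eo , inj₁ refl
    step₂ _ (u , eo , inj₂ refl) = σ₀ u , edgeOrbit-σ₀ eo , inj₂ refl

  -- unless the edge of t is glued to itself in the twisted way
  -- (σ₁ t = σ₀ σ₂ t), the two midpoint corners (t , 2) and (σ₁ t , 1) of the
  -- tile of T(4) through (t , 0) are distinct vertices
  midpoints-distinct : IsTiling T → ∀ t → σ₁ t ≢ σ₀ (σ₂ t) →
                       ¬ Reach2 (τ₁ T) (τ₂ T) (t , fs (fs f0)) (σ₁ t , fs f0)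
  midpoints-distinct tiling t untwisted path
    with atMidpoint-vertex path (t , inj₁ refl , inj₂ refl)
  ... | (u , eo , inj₂ ())
  ... | (.(σ₁ t) , eo , inj₁ refl) with eo
  ... | inj₁ σ₁t≡t = fpf₁ t σ₁t≡t
  ... | inj₂ (inj₁ σ₁t≡σ₂t) =
    proj₁ (tiling t) 1 (s≤s z≤n) (s≤s (s≤s z≤n)) (trans (cong σ₂ σ₁t≡σ₂t) (inv₂ t))
  ... | inj₂ (inj₂ (inj₁ σ₁t≡σ₀t)) =
    proj₂ (tiling t) 1 (s≤s z≤n) (s≤s (s≤s z≤n)) (trans (cong σ₁ (sym σ₁t≡σ₀t)) (inv₁ t))
  ... | inj₂ (inj₂ (inj₂ twisted)) = untwisted twisted

-- (⇒) The labelling of T(4) transported to G is good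

module QuadSubdivisionLabelling {n m : ℕ} (G : GMap n) (T : GMap m) (tilingT : IsTiling T)
                                 (I : IsoToT4 G T) where
  open GMap G
  module T = GMap T
  open Subdivision T
  open IsoToT4 I
  open Inverse φ

  to-from : ∀ p → to (from p) ≡ p
  to-from p = inverseˡ refl

  from-to : ∀ x → from (to x) ≡ x
  from-to x = inverseʳ refl

  to-injective : ∀ {a b} → to a ≡ to b → a ≡ b
  to-injective {a} {b} e = trans (sym (from-to a)) (trans (cong from e) (from-to b))

  from-com : ∀ {σ : Fin n → Fin n} {τ : Fin m × Fin 4 → Fin m × Fin 4} →
             (∀ x → to (σ x) ≡ τ (to x)) → ∀ p → from (τ p) ≡ σ (from p)
  from-com {σ} {τ} com p = to-injective (trans (to-from _) (sym (trans (com _) (cong τ (to-from p)))))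

  to-ρv : ∀ x → to (ρv G x) ≡ τρv (to x)
  to-ρv x = trans (com₂ _) (cong (τ₂ T) (com₁ x))

  to-ρf : ∀ x → to (ρf G x) ≡ τρf (to x)
  to-ρf x = trans (com₁ _) (cong (τ₁ T) (com₀ x))

  L : Labelling G
  L = (λ x → positionLabel (proj₂ (to x))) ,
      λ x → trans (cong (positionLabel ∘ proj₂) (com₁ x)) (positionLabel-τ₁ (to x)) ,
            trans (cong (positionLabel ∘ proj₂) (com₂ x)) (positionLabel-τ₂ (to x))
  ℓ = proj₁ L

  base : Fin n → Fin n
  base x = from (proj₁ (to x) , f0)

  sameFace-base : ∀ x → SameFace G x (base x)
  sameFace-base x = subst (λ z → SameFace G z (base x)) (from-to x)
    (Reach2-map from (from-com com₀) (from-com com₁) (tile-base (to x)))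

  degree-midpoint₁ : ∀ c u → to c ≡ (u , fs f0) → Degree G c 4
  degree-midpoint₁ c u e = HasPeriod-pullback to to-injective to-ρv c 4
    (subst (λ p → HasPeriod τρv p 4) (sym e) (midpoint-degree₁ u))

  degree-midpoint₂ : ∀ c u → to c ≡ (u , fs (fs f0)) → Degree G c 4
  degree-midpoint₂ c u e = HasPeriod-pullback to to-injective to-ρv c 4
    (subst (λ p → HasPeriod τρv p 4) (sym e) (midpoint-degree₂ u))

  good : GoodLabelling G L
  good x = y , sameFace-base x , tileType
    where
    t = proj₁ (to x)
    y = base x
    to-corner : ∀ k → to (corner G y k) ≡ iter τρf k (t , f0)
    to-corner k = trans (iter-conj to to-ρf k y) (cong (iter τρf k) (to-from _))
    labels : LabelPattern G ℓ y
    labels = cong (positionLabel ∘ proj₂) (to-corner 0) , cong (positionLabel ∘ proj₂) (to-corner 1) ,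
              cong (positionLabel ∘ proj₂) (to-corner 2) , cong (positionLabel ∘ proj₂) (to-corner 3)
    w₁ w₂ : Fin n
    w₁ = corner G y 1
    w₂ = corner G y 3
    deg₁ : Degree G w₁ 4
    deg₁ = degree-midpoint₂ w₁ t (to-corner 1)
    twisted-gluing : T.σ₁ t ≡ T.σ₀ (T.σ₂ t) → σ₂ (σ₁ (σ₂ w₁)) ≡ w₂
    twisted-gluing tw = to-injective (begin
      to (σ₂ (σ₁ (σ₂ w₁)))          ≡⟨ com₂ _ ⟩
      τ₂ T (to (σ₁ (σ₂ w₁)))        ≡⟨ cong (τ₂ T) (com₁ _) ⟩
      τ₂ T (τ₁ T (to (σ₂ w₁)))      ≡⟨ cong (τ₂ T ∘ τ₁ T) (trans (com₂ _) (cong (τ₂ T) (to-corner 1))) ⟩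
      (T.σ₂ (T.σ₀ t) , fs f0)       ≡⟨ cong (_, fs f0) (trans (sym (T.comm₀₂ t)) (sym tw)) ⟩
      (T.σ₁ t , fs f0)              ≡⟨ sym (to-corner 3) ⟩
      to w₂                         ∎)
      where open ≡-Reasoning
    w₁≠w₂ : T.σ₁ t ≢ T.σ₀ (T.σ₂ t) → ¬ SameVertex G w₁ w₂
    w₁≠w₂ untwisted sv = midpoints-distinct tilingT t untwisted
      (subst₂ (Reach2 (τ₁ T) (τ₂ T)) (to-corner 1) (to-corner 3) (Reach2-map to com₁ com₂ sv))
    tileType : TypeQ G ℓ y ⊎ TypeQ' G ℓ y
    tileType with T.σ₁ t ≟F T.σ₀ (T.σ₂ t)
    ... | yes tw = inj₂ (labels , stepg (stepf (stepg (Reach2-≡ (twisted-gluing tw)))) , deg₁ ,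
                         twisted-gluing tw)
    ... | no untwisted = inj₁ (LabelledTile.pattern-nonDegenerate G L labels (w₁≠w₂ untwisted) ,
                               labels , deg₁ , degree-midpoint₁ w₂ (T.σ₁ t) (to-corner 3))

-- Enumerating the elements of Fin n satisfying a boolean predicate

record Enumeration {n : ℕ} (b : Fin n → Bool) : Set where
  field
    size          : ℕ
    element       : Fin size → Fin n
    element-sat   : ∀ k → b (element k) ≡ true
    index         : ∀ z → b z ≡ true → Fin size
    element-index : ∀ z p → element (index z p) ≡ z
    index-element : ∀ k p → index (element k) p ≡ k

enumeration-keep : ∀ {n} {b : Fin (suc n) → Bool} → b f0 ≡ true → Enumeration (b ∘ fs) → Enumeration b
enumeration-keep {n} {b} b0 E = record
  { size = suc size ; element = element' ; element-sat = sat ; index = index'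
  ; element-index = element-index' ; index-element = index-element' }
  where
  open Enumeration E
  element' : Fin (suc size) → Fin (suc n)
  element' f0 = f0
  element' (fs k) = fs (element k)
  sat : ∀ k → b (element' k) ≡ true
  sat f0 = b0
  sat (fs k) = element-sat k
  index' : ∀ z → b z ≡ true → Fin (suc size)
  index' f0 _ = f0
  index' (fs z) p = fs (index z p)
  element-index' : ∀ z p → element' (index' z p) ≡ z
  element-index' f0 _ = refl
  element-index' (fs z) p = cong fs (element-index z p)
  index-element' : ∀ k p → index' (element' k) p ≡ k
  index-element' f0 _ = refl
  index-element' (fs k) p = cong fs (index-element k p)

enumeration-skip : ∀ {n} {b : Fin (suc n) → Bool} → b f0 ≡ false → Enumeration (b ∘ fs) → Enumeration b
enumeration-skip {n} {b} b0 E = record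
  { size = size ; element = fs ∘ element ; element-sat = element-sat ; index = index'
  ; element-index = element-index' ; index-element = index-element }
  where
  open Enumeration E
  notFirst : b f0 ≢ true
  notFirst p with trans (sym b0) p
  ... | ()
  index' : ∀ z → b z ≡ true → Fin size
  index' f0 p = ⊥-elim (notFirst p)
  index' (fs z) p = index z p
  element-index' : ∀ z p → fs (element (index' z p)) ≡ z
  element-index' f0 p = ⊥-elim (notFirst p)
  element-index' (fs z) p = cong fs (element-index z p)

enumerate : ∀ {n} (b : Fin n → Bool) → Enumeration b
enumerate {zero} b = record
  { size = 0 ; element = λ () ; element-sat = λ () ; index = λ ()
  ; element-index = λ () ; index-element = λ () }
enumerate {suc n} b with b f0 in b0
... | true = enumeration-keep b0 (enumerate (b ∘ fs))
... | false = enumeration-skip b0 (enumerate (b ∘ fs))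

module EnumerationProperties {n : ℕ} {b : Fin n → Bool} (E : Enumeration b) where
  open Enumeration E

  index-irrelevant : ∀ {z z'} p p' → z ≡ z' → index z p ≡ index z' p'
  index-irrelevant {z} p p' refl = cong (index z) (Decidable⇒UIP.≡-irrelevant _≟B_ p p')

  index-of : ∀ z p k → z ≡ element k → index z p ≡ k
  index-of z p k e = trans (index-irrelevant p (element-sat k) e) (index-element k (element-sat k))

  element-injective : ∀ {k k'} → element k ≡ element k' → k ≡ k'
  element-injective {k} {k'} e = trans (sym (index-element k (element-sat k))) (index-of _ _ k' e)

-- (⇐) A good labelling exhibits G as a quadrilateral subdivision

conj-involution : ∀ {A : Set} {f g : A → A} → Involution f → Involution g →
                  Involution (λ x → f (g (f x)))
conj-involution {f = f} {g} if ig x =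
  trans (cong (f ∘ g) (if (g (f x)))) (trans (cong f (ig (f x))) (if x))

-- the eight flags of a quadrilateral tile: Kᵢ lies at corner i and on the
-- edge from corner i to corner i+1, and Sᵢ = σ₀ Kᵢ
data TilePos : Set where
  K0 S0 K1 S1 K2 S2 K3 S3 : TilePos

pos-σ₀ pos-σ₁ : TilePos → TilePos
pos-σ₀ K0 = S0
pos-σ₀ S0 = K0
pos-σ₀ K1 = S1
pos-σ₀ S1 = K1
pos-σ₀ K2 = S2
pos-σ₀ S2 = K2
pos-σ₀ K3 = S3
pos-σ₀ S3 = K3
pos-σ₁ K0 = S3
pos-σ₁ K1 = S0
pos-σ₁ K2 = S1
pos-σ₁ K3 = S2
pos-σ₁ S0 = K1
pos-σ₁ S1 = K2
pos-σ₁ S2 = K3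
pos-σ₁ S3 = K0

posLabel : TilePos → Label
posLabel K0 = bullet
posLabel S0 = unlabelled
posLabel K1 = unlabelled
posLabel S1 = circ
posLabel K2 = circ
posLabel S2 = unlabelled
posLabel K3 = unlabelled
posLabel S3 = bullet

-- the possible labels of the vertex of a flag w, of the other end σ₀ w of
-- its edge, and of the other end σ₀ σ₁ w of the adjacent edge
data LocalPattern : Label → Label → Label → Set where
  atBullet     : LocalPattern bullet unlabelled unlabelled
  towardBullet : LocalPattern unlabelled bullet circ
  towardCirc   : LocalPattern unlabelled circ bullet
  atCirc       : LocalPattern circ unlabelled unlabelled

pos-localPattern : ∀ p → LocalPattern (posLabel p) (posLabel (pos-σ₀ p)) (posLabel (pos-σ₀ (pos-σ₁ p)))
pos-localPattern K0 = atBullet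
pos-localPattern S0 = towardBullet
pos-localPattern K1 = towardCirc
pos-localPattern S1 = atCirc
pos-localPattern K2 = atCirc
pos-localPattern S2 = towardCirc
pos-localPattern K3 = towardBullet
pos-localPattern S3 = atBullet

localPattern-bullet : ∀ {a b c} → LocalPattern a b c → a ≡ bullet → b ≡ unlabelled
localPattern-bullet atBullet _ = refl
localPattern-bullet towardBullet ()
localPattern-bullet towardCirc ()
localPattern-bullet atCirc ()

localPattern-towardBullet : ∀ {a b c} → LocalPattern a b c → b ≡ bullet → c ≡ circ
localPattern-towardBullet atBullet ()
localPattern-towardBullet towardBullet _ = refl
localPattern-towardBullet towardCirc ()
localPattern-towardBullet atCirc ()

localPattern-towardCirc : ∀ {a b c} → LocalPattern a b c → b ≡ circ → c ≡ bullet
localPattern-towardCirc atBullet ()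
localPattern-towardCirc towardBullet ()
localPattern-towardCirc towardCirc _ = refl
localPattern-towardCirc atCirc ()

localPattern-edge : ∀ {a b c} → LocalPattern a b c → a ≡ unlabelled → b ≢ unlabelled
localPattern-edge atBullet () _
localPattern-edge towardBullet _ ()
localPattern-edge towardCirc _ ()
localPattern-edge atCirc () _

isBullet : Label → Bool
isBullet bullet = true
isBullet circ = false
isBullet unlabelled = false

isBullet-sound : ∀ {a} → isBullet a ≡ true → a ≡ bullet
isBullet-sound {bullet} _ = refl
isBullet-sound {circ} ()
isBullet-sound {unlabelled} ()

module QuadSubdivisionFromLabelling {n : ℕ} (G : GMap n) (quadTiling : IsQuadTiling G)
  (ℓ : Fin n → Label) (vertexConstant : ∀ x → (ℓ (GMap.σ₁ G x) ≡ ℓ x) × (ℓ (GMap.σ₂ G x) ≡ ℓ x))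
  (good : GoodLabelling G (ℓ , vertexConstant)) where
  open GMap G
  open VertexRotation G

  ℓ-σ₁ : ∀ x → ℓ (σ₁ x) ≡ ℓ x
  ℓ-σ₁ x = proj₁ (vertexConstant x)

  ℓ-σ₂ : ∀ x → ℓ (σ₂ x) ≡ ℓ x
  ℓ-σ₂ x = proj₂ (vertexConstant x)

  ρf⁻¹ : Fin n → Fin n
  ρf⁻¹ x = σ₀ (σ₁ x)

  ρf⁻¹-ρf : ∀ x → ρf⁻¹ (ρf G x) ≡ x
  ρf⁻¹-ρf x = trans (cong σ₀ (inv₁ (σ₀ x))) (inv₀ x)

  ρf-ρf⁻¹ : ∀ x → ρf G (ρf⁻¹ x) ≡ x
  ρf-ρf⁻¹ x = trans (cong σ₁ (inv₀ (σ₁ x))) (inv₁ x)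

  -- every tile is a quadrilateral, so going twice forward or twice backward
  -- along its boundary leads to the same flag
  tile-halfTurn : ∀ x → iter (ρf G) 2 x ≡ iter ρf⁻¹ 2 x
  tile-halfTurn x = half-turn {f = ρf G} {ρf⁻¹} ρf⁻¹-ρf x (proj₁ (proj₂ (proj₂ quadTiling x)))

  tileFlag : Fin n → TilePos → Fin n
  tileFlag y K0 = corner G y 0
  tileFlag y S0 = σ₀ (corner G y 0)
  tileFlag y K1 = corner G y 1
  tileFlag y S1 = σ₀ (corner G y 1)
  tileFlag y K2 = corner G y 2
  tileFlag y S2 = σ₀ (corner G y 2)
  tileFlag y K3 = corner G y 3
  tileFlag y S3 = σ₀ (corner G y 3)

  -- σ₀ and σ₁ act on these flags as on the positions (closing up the tile uses ρf⁴ = id)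
  tileFlag-σ₀ : ∀ y p → σ₀ (tileFlag y p) ≡ tileFlag y (pos-σ₀ p)
  tileFlag-σ₀ y K0 = refl
  tileFlag-σ₀ y S0 = inv₀ _
  tileFlag-σ₀ y K1 = refl
  tileFlag-σ₀ y S1 = inv₀ _
  tileFlag-σ₀ y K2 = refl
  tileFlag-σ₀ y S2 = inv₀ _
  tileFlag-σ₀ y K3 = refl
  tileFlag-σ₀ y S3 = inv₀ _

  tileFlag-σ₁ : ∀ y p → σ₁ (tileFlag y p) ≡ tileFlag y (pos-σ₁ p)
  tileFlag-σ₁ y K0 = trans (cong σ₁ (sym (proj₁ (proj₂ (proj₂ quadTiling y))))) (inv₁ _)
  tileFlag-σ₁ y K1 = inv₁ _
  tileFlag-σ₁ y K2 = inv₁ _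
  tileFlag-σ₁ y K3 = inv₁ _
  tileFlag-σ₁ y S0 = refl
  tileFlag-σ₁ y S1 = refl
  tileFlag-σ₁ y S2 = refl
  tileFlag-σ₁ y S3 = proj₁ (proj₂ (proj₂ quadTiling y))

  tileFlag-complete : ∀ {x y} → SameFace G x y → Σ TilePos λ p → x ≡ tileFlag y p
  tileFlag-complete done = K0 , refl
  tileFlag-complete {x} {y} (stepf r) with tileFlag-complete r
  ... | p , e = pos-σ₀ p , trans (sym (inv₀ x)) (trans (cong σ₀ e) (tileFlag-σ₀ y p))
  tileFlag-complete {x} {y} (stepg r) with tileFlag-complete r
  ... | p , e = pos-σ₁ p , trans (sym (inv₁ x)) (trans (cong σ₁ e) (tileFlag-σ₁ y p))

  tileFlag-label : ∀ {y} → LabelPattern G ℓ y → ∀ p → ℓ (tileFlag y p) ≡ posLabel p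
  tileFlag-label (l₀ , l₁ , l₂ , l₃) K0 = l₀
  tileFlag-label (l₀ , l₁ , l₂ , l₃) K1 = l₁
  tileFlag-label (l₀ , l₁ , l₂ , l₃) K2 = l₂
  tileFlag-label (l₀ , l₁ , l₂ , l₃) K3 = l₃
  tileFlag-label (l₀ , l₁ , l₂ , l₃) S0 = trans (sym (ℓ-σ₁ _)) l₁
  tileFlag-label (l₀ , l₁ , l₂ , l₃) S1 = trans (sym (ℓ-σ₁ _)) l₂
  tileFlag-label (l₀ , l₁ , l₂ , l₃) S2 = trans (sym (ℓ-σ₁ _)) l₃
  tileFlag-label {y} (l₀ , l₁ , l₂ , l₃) S3 =
    trans (sym (ℓ-σ₁ _)) (trans (cong ℓ (proj₁ (proj₂ (proj₂ quadTiling y)))) l₀)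

  TileType : Fin n → Set
  TileType y = TypeQ G ℓ y ⊎ TypeQ' G ℓ y

  tileType-labels : ∀ {y} → TileType y → LabelPattern G ℓ y
  tileType-labels (inj₁ q) = proj₁ (proj₂ q)
  tileType-labels (inj₂ q) = proj₁ q

  tileType-degree₁ : ∀ {y} → TileType y → Degree G (corner G y 1) 4
  tileType-degree₁ (inj₁ (_ , _ , d₁ , _)) = d₁
  tileType-degree₁ (inj₂ (_ , _ , d₁ , _)) = d₁

  tileType-degree₃ : ∀ {y} → TileType y → Degree G (corner G y 3) 4
  tileType-degree₃ (inj₁ (_ , _ , _ , d₃)) = d₃
  tileType-degree₃ (inj₂ (_ , w₁~w₂ , d₁ , _)) = degree-sameVertex w₁~w₂ d₁

  localPattern : ∀ w → LocalPattern (ℓ w) (ℓ (σ₀ w)) (ℓ (σ₀ (σ₁ w)))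
  localPattern w with good w
  ... | y , sameFace , type with tileFlag-complete sameFace
  ... | p , e = subst₂ (λ a b → LocalPattern a b _) (sym labelHere) (sym labelOpposite)
                  (subst (LocalPattern _ _) (sym labelNext) (pos-localPattern p))
    where
    labels = tileType-labels type
    labelHere : ℓ w ≡ posLabel p
    labelHere = trans (cong ℓ e) (tileFlag-label labels p)
    labelOpposite : ℓ (σ₀ w) ≡ posLabel (pos-σ₀ p)
    labelOpposite = trans (cong ℓ (trans (cong σ₀ e) (tileFlag-σ₀ y p))) (tileFlag-label labels (pos-σ₀ p))
    labelNext : ℓ (σ₀ (σ₁ w)) ≡ posLabel (pos-σ₀ (pos-σ₁ p))
    labelNext = trans (cong ℓ (trans (cong σ₀ (trans (cong σ₁ e) (tileFlag-σ₁ y p))) (tileFlag-σ₀ y (pos-σ₁ p))))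
                      (tileFlag-label labels (pos-σ₀ (pos-σ₁ p)))

  unlabelled-degree4 : ∀ w → ℓ w ≡ unlabelled → Degree G w 4
  unlabelled-degree4 w unl with good w
  ... | y , sameFace , type with tileFlag-complete sameFace
  ... | p , e = atPos p e
    where
    viaCorner : ∀ {c} → SameVertex G w c → Degree G c 4 → Degree G w 4
    viaCorner sv = degree-sameVertex (Reach2-sym inv₁ inv₂ sv)
    labelled : ∀ p → w ≡ tileFlag y p → posLabel p ≢ unlabelled → ⊥
    labelled p e l≢u = l≢u (trans (sym (tileFlag-label (tileType-labels type) p)) (trans (sym (cong ℓ e)) unl))
    atPos : ∀ p → w ≡ tileFlag y p → Degree G w 4
    atPos K0 e = ⊥-elim (labelled K0 e λ ())
    atPos S1 e = ⊥-elim (labelled S1 e λ ())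
    atPos K2 e = ⊥-elim (labelled K2 e λ ())
    atPos S3 e = ⊥-elim (labelled S3 e λ ())
    atPos K1 e = viaCorner (Reach2-≡ e) (tileType-degree₁ type)
    atPos S0 e = viaCorner (stepf (Reach2-≡ (trans (cong σ₁ e) (tileFlag-σ₁ y S0)))) (tileType-degree₁ type)
    atPos K3 e = viaCorner (Reach2-≡ e) (tileType-degree₃ type)
    atPos S2 e = viaCorner (stepf (Reach2-≡ (trans (cong σ₁ e) (tileFlag-σ₁ y S2)))) (tileType-degree₃ type)

  -- the flag of the tile centre opposite to a flag
  centre : Fin n → Fin n
  centre z = σ₀ (σ₁ (σ₀ z))

  centre-involutive : Involution centre
  centre-involutive = conj-involution {f = σ₀} {σ₁} inv₀ inv₁

  bullet-σ₀ : ∀ z → ℓ z ≡ bullet → ℓ (σ₀ z) ≡ unlabelled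
  bullet-σ₀ z = localPattern-bullet (localPattern z)

  bullet-centre : ∀ z → ℓ z ≡ bullet → ℓ (centre z) ≡ circ
  bullet-centre z b = localPattern-towardBullet (localPattern (σ₀ z)) (trans (cong ℓ (inv₀ z)) b)

  circ-centre : ∀ z → ℓ z ≡ circ → ℓ (centre z) ≡ bullet
  circ-centre z c = localPattern-towardCirc (localPattern (σ₀ z)) (trans (cong ℓ (inv₀ z)) c)

  -- the •-flags of G are the flags of T
  B : Enumeration (isBullet ∘ ℓ)
  B = enumerate (isBullet ∘ ℓ)
  open Enumeration B renaming (size to m; element to flag)
  open EnumerationProperties B renaming (element-injective to flag-injective)

  flag-bullet : ∀ k → ℓ (flag k) ≡ bullet
  flag-bullet k = isBullet-sound (element-sat k)

  bulletIndex : ∀ z → ℓ z ≡ bullet → Fin m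
  bulletIndex z b = index z (cong isBullet b)

  -- σ₀ of T: cross the (unlabelled, degree 4) midpoint of the edge of T
  crossEdge : Fin n → Fin n
  crossEdge z = σ₀ (σ₁ (σ₂ (σ₁ (σ₀ z))))

  crossEdge-involutive : Involution crossEdge
  crossEdge-involutive = conj-involution {f = σ₀} {λ x → σ₁ (σ₂ (σ₁ x))} inv₀ (conj-involution {f = σ₁} {σ₂} inv₁ inv₂)

  crossEdge-σ₁σ₀ : ∀ z → σ₁ (σ₀ (crossEdge z)) ≡ σ₂ (σ₁ (σ₀ z))
  crossEdge-σ₁σ₀ z = ρf-ρf⁻¹ _

  -- σ₀ of T has no fixed points, since σ₂ has none
  crossEdge-fpf : ∀ z → crossEdge z ≢ z
  crossEdge-fpf z e = fpf₂ (σ₁ (σ₀ z)) (trans (sym (crossEdge-σ₁σ₀ z)) (cong (λ u → σ₁ (σ₀ u)) e))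

  crossEdge-bullet : ∀ z → ℓ z ≡ bullet → ℓ (crossEdge z) ≡ bullet
  crossEdge-bullet z b = localPattern-towardCirc (localPattern w) circAcross
    where
    w = σ₂ (σ₁ (σ₀ z))
    circAcross : ℓ (σ₀ w) ≡ circ
    circAcross = trans (cong ℓ (comm₀₂ (σ₁ (σ₀ z)))) (trans (ℓ-σ₂ _) (bullet-centre z b))

  -- at the degree-4 midpoint w = σ₀ z, crossing the edge commutes with σ₂
  crossEdge-via-midpoint : ∀ z → crossEdge (σ₂ z) ≡ σ₀ (iter ρv⁻¹ 2 (σ₀ z))
  crossEdge-via-midpoint z = cong (λ u → σ₀ (σ₁ (σ₂ (σ₁ u)))) (comm₀₂ z)

  crossEdge-σ₂ : ∀ z → ℓ z ≡ bullet → crossEdge (σ₂ z) ≡ σ₂ (crossEdge z)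
  crossEdge-σ₂ z b = begin
    crossEdge (σ₂ z)          ≡⟨ crossEdge-via-midpoint z ⟩
    σ₀ (iter ρv⁻¹ 2 w)        ≡⟨ cong σ₀ (sym (half-turn {f = ρv G} {ρv⁻¹} ρv⁻¹-ρv w (proj₁ (proj₂ degree4)))) ⟩
    σ₀ (iter (ρv G) 2 w)      ≡⟨ comm₀₂ _ ⟩
    σ₂ (crossEdge z)          ∎
    where
    open ≡-Reasoning
    w = σ₀ z
    degree4 = unlabelled-degree4 w (bullet-σ₀ z b)

  -- σ₀σ₂ of T has no fixed points, since the midpoint has degree exactly 4
  crossEdge-σ₂-fpf : ∀ z → ℓ z ≡ bullet → crossEdge (σ₂ z) ≢ z
  crossEdge-σ₂-fpf z b e = proj₂ (proj₂ degree4) 2 (s≤s z≤n) (s≤s (s≤s (s≤s z≤n)))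
    (fixed-inverse {f = ρv⁻¹} {ρv G} ρv-ρv⁻¹ 2 w (trans (sym (inv₀ _)) (cong σ₀ (trans (sym (crossEdge-via-midpoint z)) e))))
    where
    w = σ₀ z
    degree4 = unlabelled-degree4 w (bullet-σ₀ z b)

  -- rotating around a centre corresponds to moving along a tile of T
  centre-rotation : ∀ z → ρv⁻¹ (centre z) ≡ centre (σ₁ (crossEdge z))
  centre-rotation z = begin
    σ₁ (σ₂ (σ₀ (σ₁ (σ₀ z))))       ≡⟨ cong σ₁ (sym (comm₀₂ _)) ⟩
    σ₁ (σ₀ u)                      ≡⟨ sym (cong (ρf G) (ρf-ρf⁻¹ u)) ⟩
    iter (ρf G) 2 (ρf⁻¹ u)         ≡⟨ tile-halfTurn (ρf⁻¹ u) ⟩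
    iter ρf⁻¹ 2 (ρf⁻¹ u)           ∎
    where
    open ≡-Reasoning
    u = σ₂ (σ₁ (σ₀ z))

  σ₀ᵀ σ₁ᵀ σ₂ᵀ : Fin m → Fin m
  σ₀ᵀ k = bulletIndex (crossEdge (flag k)) (crossEdge-bullet _ (flag-bullet k))
  σ₁ᵀ k = bulletIndex (σ₁ (flag k)) (trans (ℓ-σ₁ _) (flag-bullet k))
  σ₂ᵀ k = bulletIndex (σ₂ (flag k)) (trans (ℓ-σ₂ _) (flag-bullet k))

  flag-σ₀ᵀ : ∀ k → flag (σ₀ᵀ k) ≡ crossEdge (flag k)
  flag-σ₀ᵀ k = element-index _ _
  flag-σ₁ᵀ : ∀ k → flag (σ₁ᵀ k) ≡ σ₁ (flag k)
  flag-σ₁ᵀ k = element-index _ _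
  flag-σ₂ᵀ : ∀ k → flag (σ₂ᵀ k) ≡ σ₂ (flag k)
  flag-σ₂ᵀ k = element-index _ _

  index-flag : ∀ z b k → z ≡ flag k → bulletIndex z b ≡ k
  index-flag z b = index-of z (cong isBullet b)

  -- the four subdivision flags of a •-flag z: at the vertex, twice at the
  -- edge midpoint, and at the tile centre
  subdivisionFlag : Fin n → Fin 4 → Fin n
  subdivisionFlag z f0 = z
  subdivisionFlag z (fs f0) = σ₀ z
  subdivisionFlag z (fs (fs f0)) = σ₁ (σ₀ z)
  subdivisionFlag z (fs (fs (fs f0))) = centre z

  fromSubdivision : Fin m × Fin 4 → Fin n
  fromSubdivision (k , i) = subdivisionFlag (flag k) i

  -- conversely, the •-flag and position of a flag w are read off from the
  -- labels at the two ends of its edge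
  decomposeBy : (w : Fin n) (a c : Label) → ℓ w ≡ a → ℓ (σ₀ w) ≡ c → Fin m × Fin 4
  decomposeBy w bullet _ b _ = bulletIndex w b , f0
  decomposeBy w circ _ c _ = bulletIndex (centre w) (circ-centre w c) , fs (fs (fs f0))
  decomposeBy w unlabelled bullet _ b = bulletIndex (σ₀ w) b , fs f0
  decomposeBy w unlabelled circ _ c =
    bulletIndex (σ₀ (σ₁ w)) (localPattern-towardCirc (localPattern w) c) , fs (fs f0)
  decomposeBy w unlabelled unlabelled u u' = ⊥-elim (localPattern-edge (localPattern w) u u')

  decompose : Fin n → Fin m × Fin 4
  decompose w = decomposeBy w (ℓ w) (ℓ (σ₀ w)) refl refl

  decompose-≡ : ∀ w {a c} (p : ℓ w ≡ a) (q : ℓ (σ₀ w) ≡ c) → decompose w ≡ decomposeBy w a c p q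
  decompose-≡ w refl refl = refl

  decompose-subdivisionFlag : ∀ p → decompose (fromSubdivision p) ≡ p
  decompose-subdivisionFlag (k , f0) =
    trans (decompose-≡ z (flag-bullet k) refl) (cong (_, f0) (index-flag z _ k refl))
    where z = flag k
  decompose-subdivisionFlag (k , fs f0) =
    trans (decompose-≡ (σ₀ z) (bullet-σ₀ z (flag-bullet k)) (trans (cong ℓ (inv₀ z)) (flag-bullet k)))
          (cong (_, fs f0) (index-flag _ _ k (inv₀ z)))
    where z = flag k
  decompose-subdivisionFlag (k , fs (fs f0)) =
    trans (decompose-≡ (σ₁ (σ₀ z)) (trans (ℓ-σ₁ _) (bullet-σ₀ z (flag-bullet k))) (bullet-centre z (flag-bullet k)))
          (cong (_, fs (fs f0)) (index-flag _ _ k (ρf⁻¹-ρf z)))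
    where z = flag k
  decompose-subdivisionFlag (k , fs (fs (fs f0))) =
    trans (decompose-≡ (centre z) (bullet-centre z (flag-bullet k)) refl)
          (cong (_, fs (fs (fs f0))) (index-flag _ _ k (centre-involutive z)))
    where z = flag k

  subdivisionFlag-decomposeBy : ∀ w a c p q → fromSubdivision (decomposeBy w a c p q) ≡ w
  subdivisionFlag-decomposeBy w bullet _ _ _ = element-index _ _
  subdivisionFlag-decomposeBy w circ _ _ _ = trans (cong centre (element-index _ _)) (centre-involutive w)
  subdivisionFlag-decomposeBy w unlabelled bullet _ _ = trans (cong σ₀ (element-index _ _)) (inv₀ w)
  subdivisionFlag-decomposeBy w unlabelled circ _ _ = trans (cong (σ₁ ∘ σ₀) (element-index _ _)) (ρf-ρf⁻¹ w)
  subdivisionFlag-decomposeBy w unlabelled unlabelled u u' = ⊥-elim (localPattern-edge (localPattern w) u u')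

  subdivisionFlag-decompose : ∀ w → fromSubdivision (decompose w) ≡ w
  subdivisionFlag-decompose w = subdivisionFlag-decomposeBy w _ _ refl refl

  -- the involutions of T(4), written before T is assembled into a map
  τ₀ᵀ τ₁ᵀ τ₂ᵀ : Fin m × Fin 4 → Fin m × Fin 4
  τ₀ᵀ (k , f0)              = (k , fs f0)
  τ₀ᵀ (k , fs f0)           = (k , f0)
  τ₀ᵀ (k , fs (fs f0))      = (k , fs (fs (fs f0)))
  τ₀ᵀ (k , fs (fs (fs f0))) = (k , fs (fs f0))
  τ₁ᵀ (k , f0)              = (σ₁ᵀ k , f0)
  τ₁ᵀ (k , fs f0)           = (k , fs (fs f0))
  τ₁ᵀ (k , fs (fs f0))      = (k , fs f0)
  τ₁ᵀ (k , fs (fs (fs f0))) = (σ₁ᵀ k , fs (fs (fs f0)))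
  τ₂ᵀ (k , f0)              = (σ₂ᵀ k , f0)
  τ₂ᵀ (k , fs f0)           = (σ₂ᵀ k , fs f0)
  τ₂ᵀ (k , fs (fs f0))      = (σ₀ᵀ k , fs (fs f0))
  τ₂ᵀ (k , fs (fs (fs f0))) = (σ₀ᵀ k , fs (fs (fs f0)))

  fromSubdivision-σ₀ : ∀ p → σ₀ (fromSubdivision p) ≡ fromSubdivision (τ₀ᵀ p)
  fromSubdivision-σ₀ (k , f0) = refl
  fromSubdivision-σ₀ (k , fs f0) = inv₀ _
  fromSubdivision-σ₀ (k , fs (fs f0)) = refl
  fromSubdivision-σ₀ (k , fs (fs (fs f0))) = inv₀ _

  fromSubdivision-σ₁ : ∀ p → σ₁ (fromSubdivision p) ≡ fromSubdivision (τ₁ᵀ p)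
  fromSubdivision-σ₁ (k , f0) = sym (flag-σ₁ᵀ k)
  fromSubdivision-σ₁ (k , fs f0) = refl
  fromSubdivision-σ₁ (k , fs (fs f0)) = inv₁ _
  fromSubdivision-σ₁ (k , fs (fs (fs f0))) = trans (tile-halfTurn (flag k)) (cong centre (sym (flag-σ₁ᵀ k)))

  fromSubdivision-σ₂ : ∀ p → σ₂ (fromSubdivision p) ≡ fromSubdivision (τ₂ᵀ p)
  fromSubdivision-σ₂ (k , f0) = sym (flag-σ₂ᵀ k)
  fromSubdivision-σ₂ (k , fs f0) = trans (sym (comm₀₂ (flag k))) (cong σ₀ (sym (flag-σ₂ᵀ k)))
  fromSubdivision-σ₂ (k , fs (fs f0)) =
    trans (sym (crossEdge-σ₁σ₀ (flag k))) (cong (σ₁ ∘ σ₀) (sym (flag-σ₀ᵀ k)))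
  fromSubdivision-σ₂ (k , fs (fs (fs f0))) =
    trans (sym (comm₀₂ _)) (trans (cong σ₀ (sym (crossEdge-σ₁σ₀ (flag k)))) (cong centre (sym (flag-σ₀ᵀ k))))

  decompose-com : ∀ {σ : Fin n → Fin n} {τ : Fin m × Fin 4 → Fin m × Fin 4} →
    (∀ p → σ (fromSubdivision p) ≡ fromSubdivision (τ p)) → ∀ w → decompose (σ w) ≡ τ (decompose w)
  decompose-com {σ} {τ} com w = begin
    decompose (σ w)                                ≡⟨ cong (decompose ∘ σ) (sym (subdivisionFlag-decompose w)) ⟩
    decompose (σ (fromSubdivision (decompose w)))  ≡⟨ cong decompose (com _) ⟩
    decompose (fromSubdivision (τ (decompose w)))  ≡⟨ decompose-subdivisionFlag _ ⟩
    τ (decompose w)                                ∎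
    where open ≡-Reasoning

  -- T is connected: a path in G projects to a path between the •-flags
  ReachT : Fin m → Fin m → Set
  ReachT = Reach3 σ₀ᵀ σ₁ᵀ σ₂ᵀ

  baseIndex : Fin n → Fin m
  baseIndex w = proj₁ (decompose w)

  baseIndex-step : ∀ {σ : Fin n → Fin n} {τ : Fin m × Fin 4 → Fin m × Fin 4} →
    (∀ p → σ (fromSubdivision p) ≡ fromSubdivision (τ p)) → (∀ p → ReachT (proj₁ p) (proj₁ (τ p))) →
    ∀ w → ReachT (baseIndex w) (baseIndex (σ w))
  baseIndex-step {τ = τ} com τ-reach w =
    subst (ReachT (baseIndex w) ∘ proj₁) (sym (decompose-com {τ = τ} com w)) (τ-reach (decompose w))

  τ₀ᵀ-reach : ∀ p → ReachT (proj₁ p) (proj₁ (τ₀ᵀ p))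
  τ₀ᵀ-reach (k , f0) = done
  τ₀ᵀ-reach (k , fs f0) = done
  τ₀ᵀ-reach (k , fs (fs f0)) = done
  τ₀ᵀ-reach (k , fs (fs (fs f0))) = done

  τ₁ᵀ-reach : ∀ p → ReachT (proj₁ p) (proj₁ (τ₁ᵀ p))
  τ₁ᵀ-reach (k , f0) = stepg done
  τ₁ᵀ-reach (k , fs f0) = done
  τ₁ᵀ-reach (k , fs (fs f0)) = done
  τ₁ᵀ-reach (k , fs (fs (fs f0))) = stepg done

  τ₂ᵀ-reach : ∀ p → ReachT (proj₁ p) (proj₁ (τ₂ᵀ p))
  τ₂ᵀ-reach (k , f0) = steph done
  τ₂ᵀ-reach (k , fs f0) = steph done
  τ₂ᵀ-reach (k , fs (fs f0)) = stepf done
  τ₂ᵀ-reach (k , fs (fs (fs f0))) = stepf done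

  baseIndex-path : ∀ {x y} → Reach3 σ₀ σ₁ σ₂ x y → ReachT (baseIndex x) (baseIndex y)
  baseIndex-path done = done
  baseIndex-path {x} (stepf r) = Reach3-trans (baseIndex-step {τ = τ₀ᵀ} fromSubdivision-σ₀ τ₀ᵀ-reach x) (baseIndex-path r)
  baseIndex-path {x} (stepg r) = Reach3-trans (baseIndex-step {τ = τ₁ᵀ} fromSubdivision-σ₁ τ₁ᵀ-reach x) (baseIndex-path r)
  baseIndex-path {x} (steph r) = Reach3-trans (baseIndex-step {τ = τ₂ᵀ} fromSubdivision-σ₂ τ₂ᵀ-reach x) (baseIndex-path r)

  T-connected : ∀ k k' → ReachT k k'
  T-connected k k' = subst₂ ReachT (baseIndex-flag k) (baseIndex-flag k') (baseIndex-path (connected (flag k) (flag k')))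
    where
    baseIndex-flag : ∀ k → baseIndex (flag k) ≡ k
    baseIndex-flag k = cong proj₁ (decompose-subdivisionFlag (k , f0))

  flag-σ₀ᵀσ₂ᵀ : ∀ k → flag (σ₀ᵀ (σ₂ᵀ k)) ≡ crossEdge (σ₂ (flag k))
  flag-σ₀ᵀσ₂ᵀ k = trans (flag-σ₀ᵀ _) (cong crossEdge (flag-σ₂ᵀ k))

  T : GMap m
  T = record
    { σ₀ = σ₀ᵀ ; σ₁ = σ₁ᵀ ; σ₂ = σ₂ᵀ
    ; inv₀ = λ k → flag-injective (trans (flag-σ₀ᵀ _) (trans (cong crossEdge (flag-σ₀ᵀ k)) (crossEdge-involutive _)))
    ; inv₁ = λ k → flag-injective (trans (flag-σ₁ᵀ _) (trans (cong σ₁ (flag-σ₁ᵀ k)) (inv₁ _)))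
    ; inv₂ = λ k → flag-injective (trans (flag-σ₂ᵀ _) (trans (cong σ₂ (flag-σ₂ᵀ k)) (inv₂ _)))
    ; fpf₀ = λ k h → crossEdge-fpf (flag k) (trans (sym (flag-σ₀ᵀ k)) (cong flag h))
    ; fpf₁ = λ k h → fpf₁ (flag k) (trans (sym (flag-σ₁ᵀ k)) (cong flag h))
    ; fpf₂ = λ k h → fpf₂ (flag k) (trans (sym (flag-σ₂ᵀ k)) (cong flag h))
    ; comm₀₂ = λ k → flag-injective (trans (flag-σ₀ᵀσ₂ᵀ k) (trans (crossEdge-σ₂ _ (flag-bullet k))
                       (sym (trans (flag-σ₂ᵀ _) (cong σ₂ (flag-σ₀ᵀ k))))))
    ; fpf₀₂ = λ k h → crossEdge-σ₂-fpf (flag k) (flag-bullet k) (trans (sym (flag-σ₀ᵀσ₂ᵀ k)) (cong flag h))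
    ; nonempty = baseIndex nonempty
    ; connected = T-connected
    }

  -- vertices of T are the •-vertices of G; tiles of T correspond to the
  -- ∘-vertices of G, traversed backwards
  T-tiling : IsTiling T
  T-tiling k = PeriodAtLeast3-pullback flag flag-ρvᵀ k (proj₁ (tilingG (flag k))) ,
               PeriodAtLeast3-pullback (centre ∘ flag) centre-ρfᵀ k
                 (PeriodAtLeast3-inverse {f = ρv G} ρv-ρv⁻¹ _ (proj₁ (tilingG (centre (flag k)))))
    where
    tilingG = proj₁ quadTiling
    flag-ρvᵀ : ∀ k → flag (σ₂ᵀ (σ₁ᵀ k)) ≡ ρv G (flag k)
    flag-ρvᵀ k = trans (flag-σ₂ᵀ _) (cong σ₂ (flag-σ₁ᵀ k))
    centre-ρfᵀ : ∀ k → centre (flag (σ₁ᵀ (σ₀ᵀ k))) ≡ ρv⁻¹ (centre (flag k))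
    centre-ρfᵀ k = trans (cong centre (trans (flag-σ₁ᵀ _) (cong σ₁ (flag-σ₀ᵀ k)))) (sym (centre-rotation (flag k)))

  τ₀-agree : ∀ p → τ₀ᵀ p ≡ τ₀ T p
  τ₀-agree (k , f0) = refl
  τ₀-agree (k , fs f0) = refl
  τ₀-agree (k , fs (fs f0)) = refl
  τ₀-agree (k , fs (fs (fs f0))) = refl

  τ₁-agree : ∀ p → τ₁ᵀ p ≡ τ₁ T p
  τ₁-agree (k , f0) = refl
  τ₁-agree (k , fs f0) = refl
  τ₁-agree (k , fs (fs f0)) = refl
  τ₁-agree (k , fs (fs (fs f0))) = refl

  τ₂-agree : ∀ p → τ₂ᵀ p ≡ τ₂ T p
  τ₂-agree (k , f0) = refl
  τ₂-agree (k , fs f0) = refl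
  τ₂-agree (k , fs (fs f0)) = refl
  τ₂-agree (k , fs (fs (fs f0))) = refl

  iso : IsoToT4 G T
  iso = record
    { φ = mk↔ₛ′ decompose fromSubdivision decompose-subdivisionFlag subdivisionFlag-decompose
    ; com₀ = λ w → trans (decompose-com {τ = τ₀ᵀ} fromSubdivision-σ₀ w) (τ₀-agree (decompose w))
    ; com₁ = λ w → trans (decompose-com {τ = τ₁ᵀ} fromSubdivision-σ₁ w) (τ₁-agree (decompose w))
    ; com₂ = λ w → trans (decompose-com {τ = τ₂ᵀ} fromSubdivision-σ₂ w) (τ₂-agree (decompose w))
    }

  quadSubdivision : IsQuadSubdivision G
  quadSubdivision = m , T , T-tiling , iso

theorem3p5 : ∀ {n : ℕ} (G : GMap n) → IsQuadTiling G →
    (IsQuadSubdivision G ⇔ ∃ λ (L : Labelling G) → GoodLabelling G L)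
theorem3p5 G quadTiling = mk⇔ labelling subdivision
  where
  labelling : IsQuadSubdivision G → ∃ λ (L : Labelling G) → GoodLabelling G L
  labelling (m , T , tilingT , iso) =
    QuadSubdivisionLabelling.L G T tilingT iso , QuadSubdivisionLabelling.good G T tilingT iso
  subdivision : (∃ λ (L : Labelling G) → GoodLabelling G L) → IsQuadSubdivision G
  subdivision ((ℓ , vertexConstant) , good) =
    QuadSubdivisionFromLabelling.quadSubdivision G quadTiling ℓ vertexConstant good
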